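{- Let $t\ge 1$, let $\mathcal{P}$ be a program over cores $\mathsf{Cores}$, and let $\sigma$ be a $t$-reordering bounded trace of $\mathcal{P}$. Then for all $0\le j\le|\sigma|$, $|\mathsf{IP}(j)|\le|\mathsf{Cores}|\cdot t$.
   Context: A program $\mathcal{P}$ assigns to each core $c\in\mathsf{Cores}$ a finite instruction stream; an instruction $i$ has a core $\mathsf{core}(i)$ and a label $\mathsf{label}(i)$ (its index in its stream); $\mathsf{Instrs}(\mathcal{P})$ is the set of instructions. $i'\le_r i$ means same core and $\mathsf{label}(i')\le\mathsf{label}(i)$. Events are $i.\mathsf{st}$ with $\mathsf{st}$ in a finite set of stages. A trace $\sigma=e_1\cdots e_{|\sigma|}$ of $\mathcal{P}$ is a sequence listing each event of $\mathcal{P}$ exactly once; $e\to_{hb} e'$ means $e$ occurs before $e'$ in $\sigma$. For same-core $i_1,i_2$: $\mathsf{diff}_r(i_1,i_2)=\mathsf{label}(i_2)-\mathsf{label}(i_1)$. $\mathsf{start}(i)$ (resp. $\mathsf{end}(i)$) is the smallest (resp. largest) index $j$ with $e_j$ an event of $i$; $\mathsf{pfxend}(i)=\max\{\mathsf{end}(i'): i'\le_r i\}$. $\mathsf{coup}(i_1,i_2)$ holds if the intervals $[\mathsf{start}(i_1),\mathsf{pfxend}(i_1)]$ and $[\mathsf{start}(i_2),\mathsf{pfxend}(i_2)]$ overlap. $\sigma$ is $t$-reordering bounded if for all $i_1,i_2$ on the same core: (1) if $i_2.\mathsf{st}_2\to_{hb} i_1.\mathsf{st}_1$ for some stages then $\mathsf{diff}_r(i_1,i_2)<t$;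 and (2) if $\mathsf{coup}(i_1,i)$ and $\mathsf{coup}(i,i_2)$ for some instruction $i$ then $|\mathsf{diff}_r(i_1,i_2)|<t$. For $0\le j\le|\sigma|$: $\mathsf{CM}(j)$ (resp. $\mathsf{NF}(j)$) is the set of instructions all (resp. none) of whose events are among $e_1,\ldots,e_j$; $\mathsf{pCM}(j)=\{i:\forall i'.\ i'\le_r i\Rightarrow i'\in\mathsf{CM}(j)\}$; $\mathsf{pNF}(j)=\{i:\forall i'.\ i\le_r i'\Rightarrow i'\in\mathsf{NF}(j)\}$; $\mathsf{IP}(j)=\mathsf{Instrs}(\mathcal{P})\setminus(\mathsf{pCM}(j)\cup\mathsf{pNF}(j))$. -}

module Defs where

open import Data.Nat using (ℕ; zero; suc; _≤_; _<_; _⊓_; _⊔_; _≤?_; _<?_)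
open import Data.Integer using (ℤ; _⊖_; +_; ∣_∣) renaming (_<_ to _<ℤ_)
open import Data.Fin using (Fin; toℕ)
open import Data.Fin.Properties using (all?)
open import Data.List using (List; []; _∷_; foldr; map; concatMap; filter; length; allFin)
open import Data.Product using (Σ; _×_; _,_; ∃; proj₁; proj₂)
open import Data.Sum using (_⊎_)
open import Function using (_∘_)
open import Relation.Binary.PropositionalEquality using (_≡_)
open import Function.Bundles using (_↔_; Inverse)
open import Relation.Nullary using (¬_; Dec)
open import Data.Bool using (if_then_else_)
open import Relation.Nullary.Decidable using (does; ¬?; _⊎-dec_; _→-dec_)

minF : ∀ {m} → (Fin (suc m) → ℕ) → ℕ
minF {zero}  f = f Fin.zero
minF {suc m} f = f Fin.zero ⊓ minF (f ∘ Fin.suc)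

maxF : ∀ {m} → (Fin (suc m) → ℕ) → ℕ
maxF {zero}  f = f Fin.zero
maxF {suc m} f = f Fin.zero ⊔ maxF (f ∘ Fin.suc)

-- A program: finitely many cores (Fin nCores), core c has an instruction
-- stream of length (len c); the finite (nonempty) set of stages is Fin (suc s).
record Program : Set where
  field
    nCores : ℕ
    len    : Fin nCores → ℕ
    s      : ℕ

  Core : Set
  Core = Fin nCores

  Stage : Set
  Stage = Fin (suc s)

  -- instruction i = (core(i) , label(i))
  Instr : Set
  Instr = Σ Core (λ c → Fin (len c))

  Event : Set
  Event = Instr × Stage

  _≤r_ : Instr → Instr → Set
  (c' , l') ≤r (c , l) = Σ (c' ≡ c) (λ _ → toℕ l' ≤ toℕ l)

  allInstrs : List Instr
  allInstrs = concatMap (λ c → map (c ,_) (allFin (len c))) (allFin nCores)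

  diffr : (c : Core) → Fin (len c) → Fin (len c) → ℤ
  diffr c l₁ l₂ = toℕ l₂ ⊖ toℕ l₁

-- A trace of P: a sequence e_0 ... e_{N-1} listing each event exactly once,
-- i.e. a bijection between positions Fin N and events.
record Trace (P : Program) : Set where
  open Program P
  field
    N   : ℕ
    seq : Fin N ↔ Event

  -- position (0-based) of an event in the trace
  pos : Event → ℕ
  pos e = toℕ (Inverse.from seq e)

  _→hb_ : Event → Event → Set
  e →hb e' = pos e < pos e'

  start : Instr → ℕ
  start i = minF (λ st → pos (i , st))

  end : Instr → ℕ
  end i = maxF (λ st → pos (i , st))

  pfxend : Instr → ℕ
  pfxend (c , l) =
    foldr (λ k acc → if does (toℕ k ≤? toℕ l) then end (c , k) ⊔ acc else acc)
          0 (allFin (len c))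

  coup : Instr → Instr → Set
  coup i₁ i₂ = ∃ λ x → (start i₁ ≤ x × x ≤ pfxend i₁) × (start i₂ ≤ x × x ≤ pfxend i₂)

  CM : ℕ → Instr → Set
  CM j i = ∀ st → pos (i , st) < j

  NF : ℕ → Instr → Set
  NF j i = ∀ st → j ≤ pos (i , st)

  pCM : ℕ → Instr → Set
  pCM j (c , l) = ∀ (k : Fin (len c)) → toℕ k ≤ toℕ l → CM j (c , k)

  pNF : ℕ → Instr → Set
  pNF j (c , l) = ∀ (k : Fin (len c)) → toℕ l ≤ toℕ k → NF j (c , k)

  IP : ℕ → Instr → Set
  IP j i = ¬ (pCM j i ⊎ pNF j i)

  IP? : ∀ j i → Dec (IP j i)
  IP? j (c , l) = ¬? (pCM? ⊎-dec pNF?)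
    where
      pCM? = all? (λ k → (toℕ k ≤? toℕ l) →-dec all? (λ st → pos ((c , k) , st) <? j))
      pNF? = all? (λ k → (toℕ l ≤? toℕ k) →-dec all? (λ st → j ≤? pos ((c , k) , st)))

  ∣IP∣ : ℕ → ℕ
  ∣IP∣ j = length (filter (IP? j) allInstrs)

ReorderingBounded : (P : Program) → Trace P → ℕ → Set
ReorderingBounded P σ t =
  (∀ (c : Core) (l₁ l₂ : Fin (len c)) (st₁ st₂ : Stage) →
     ((c , l₂) , st₂) →hb ((c , l₁) , st₁) → diffr c l₁ l₂ <ℤ + t)
  × (∀ (c : Core) (l₁ l₂ : Fin (len c)) (i : Instr) →
     coup (c , l₁) i → coup i (c , l₂) → ∣ diffr c l₁ l₂ ∣ < t)
  where
    open Program P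
    open Trace σ

-- If two instructions i₁, i₂ of one core had labels l₁ + t ≤ l₂, condition (1) of
-- reordering-boundedness would force every event of an instruction ≤ l₁ to occur before
-- every event of an instruction ≥ l₂.  Cutting the trace at j, either the whole prefix up
-- to l₁ is committed or the whole suffix from l₂ is not yet fetched, so i₁ and i₂ cannot
-- both be in IP(j).  Thus the labels in IP(j) on one core lie in a window of width t, and
-- each core contributes at most t instructions.
module Submission where

open import Defs
open import Data.Nat using (ℕ; _≤_; _*_; zero; suc; _+_; _<_; z≤n; s≤s; _≤?_; _<?_)
open import Data.Nat.Properties
open import Data.Integer using (_⊖_; +_) renaming (_<_ to _<ℤ_)
open import Data.Integer.Properties using (⊖-≥; drop‿+<+)
open import Data.Fin using (Fin; toℕ)
open import Data.List using (List; []; _∷_; _++_; filter; length; map; allFin; concatMap)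
open import Data.List.Properties using (filter-++; length-++; length-map; length-tabulate)
open import Data.List.Relation.Unary.All as All using (All; []; _∷_)
open import Data.List.Relation.Unary.All.Properties using (all-filter)
open import Data.List.Relation.Unary.AllPairs as AllPairs using (AllPairs; []; _∷_)
import Data.List.Relation.Unary.AllPairs.Properties as AllPairs
open import Data.Product using (_,_; proj₁)
open import Data.Sum using (inj₁; inj₂)
open import Data.Bool using (true; false)
open import Data.Empty using (⊥-elim)
open import Relation.Nullary using (yes; no; does)
open import Relation.Unary using (Decidable)
open import Relation.Binary.PropositionalEquality using (_≡_; refl; cong; subst)
open import Function using (_∘_; _on_; id)

module _ {A B : Set} {Q : B → Set} (Q? : Decidable Q) where

  filter-map : ∀ (f : A → B) xs → filter Q? (map f xs) ≡ map f (filter (Q? ∘ f) xs)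
  filter-map f []       = refl
  filter-map f (x ∷ xs) with does (Q? (f x))
  ... | true  = cong (f x ∷_) (filter-map f xs)
  ... | false = filter-map f xs

  length-filter-concatMap-≤ : ∀ {t} (f : A → List B) →
    (∀ x → length (filter Q? (f x)) ≤ t) →
    ∀ xs → length (filter Q? (concatMap f xs)) ≤ length xs * t
  length-filter-concatMap-≤ f bound []       = z≤n
  length-filter-concatMap-≤ {t} f bound (x ∷ xs) = begin
    length (filter Q? (f x ++ rest))                   ≡⟨ cong length (filter-++ Q? (f x) rest) ⟩
    length (filter Q? (f x) ++ filter Q? rest)         ≡⟨ length-++ (filter Q? (f x)) ⟩
    length (filter Q? (f x)) + length (filter Q? rest) ≤⟨ +-mono-≤ (bound x) (length-filter-concatMap-≤ f bound xs) ⟩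
    t + length xs * t                                  ∎
    where
    open ≤-Reasoning
    rest = concatMap f xs

module _ {A : Set} (κ : A → ℕ) where

  length-≤-width : ∀ {a t xs} → AllPairs (_<_ on κ) xs →
    All (λ x → a ≤ κ x) xs → All (λ x → κ x < a + t) xs → length xs ≤ t
  length-≤-width []                  []           []           = z≤n
  length-≤-width {a} {zero}  (_ ∷ _) (a≤x ∷ _) (x<a+0 ∷ _) =
    ⊥-elim (<-irrefl refl (<-≤-trans (subst (κ _ <_) (+-identityʳ a) x<a+0) a≤x))
  length-≤-width {a} {suc t} (x<xs ∷ inc) (a≤x ∷ _) (_ ∷ below) =
    s≤s (length-≤-width inc
      (All.map (<-≤-trans (s≤s a≤x)) x<xs)
      (All.map (λ {x} → subst (κ x <_) (+-suc a t)) below))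

  length-filter-≤ : ∀ {Q : A → Set} (Q? : Decidable Q) {t} →
    (∀ {x y} → Q x → Q y → κ y < κ x + t) →
    ∀ {xs} → AllPairs (_<_ on κ) xs → length (filter Q? xs) ≤ t
  length-filter-≤ {Q} Q? {t} close {xs} inc =
    bound (AllPairs.filter⁺ Q? inc) (all-filter Q? xs)
    where
    bound : ∀ {ys} → AllPairs (_<_ on κ) ys → All Q ys → length ys ≤ t
    bound []             []         = z≤n
    bound inc@(x<ys ∷ _) (qx ∷ qys) =
      length-≤-width inc (≤-refl ∷ All.map <⇒≤ x<ys) (All.map (close qx) (qx ∷ qys))

⊖<+⇒<+ : ∀ {m n t} → m ⊖ n <ℤ + t → m < n + t
⊖<+⇒<+ {m} {n} {t} m⊖n<t with n ≤? m
... | yes n≤m = subst (_< n + t) (m+[n∸m]≡n n≤m)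
                  (+-monoʳ-< n (drop‿+<+ (subst (_<ℤ + t) (⊖-≥ n≤m) m⊖n<t)))
... | no  n≰m = <-≤-trans (≰⇒> n≰m) (m≤m+n n t)

instrsOn : (P : Program) → Program.Core P → List (Program.Instr P)
instrsOn P c = map (c ,_) (allFin (Program.len P c))

module _ {P : Program} (σ : Trace P) {t : ℕ}
         (bounded : ReorderingBounded P σ t) where
  open Program P
  open Trace σ

  far-apart⇒ordered : ∀ {c} {k k' : Fin (len c)} (st st' : Stage) →
    toℕ k + t ≤ toℕ k' → pos ((c , k) , st) ≤ pos ((c , k') , st')
  far-apart⇒ordered {c} {k} {k'} st st' k+t≤k' with pos ((c , k) , st) ≤? pos ((c , k') , st')
  ... | yes ordered    = ordered
  ... | no  overtaking = ⊥-elim (<⇒≱ (⊖<+⇒<+ (proj₁ bounded c k k' st st' (≰⇒> overtaking))) k+t≤k')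

  IP-labels-close : ∀ {j c} {l₁ l₂ : Fin (len c)} →
    IP j (c , l₁) → IP j (c , l₂) → toℕ l₂ < toℕ l₁ + t
  IP-labels-close {j} {c} {l₁} {l₂} ip₁ ip₂ with toℕ l₂ <? toℕ l₁ + t
  ... | yes close = close
  ... | no  far   = ⊥-elim (ip₁ (inj₁ prefix-committed))
    where
    prefix-committed : pCM j (c , l₁)
    prefix-committed k k≤l₁ st with pos ((c , k) , st) <? j
    ... | yes committed = committed
    ... | no  pending   = ⊥-elim (ip₂ (inj₂ λ k' l₂≤k' st' →
          ≤-trans (≮⇒≥ pending)
            (far-apart⇒ordered st st' (≤-trans (+-monoˡ-≤ t k≤l₁) (≤-trans (≮⇒≥ far) l₂≤k')))))

  ∣IP∣-on-core : ∀ j c → length (filter (IP? j) (instrsOn P c)) ≤ t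
  ∣IP∣-on-core j c = begin
    length (filter (IP? j) (map at (allFin (len c))))       ≡⟨ cong length (filter-map (IP? j) at (allFin (len c))) ⟩
    length (map at (filter (IP? j ∘ at) (allFin (len c))))  ≡⟨ length-map at (filter (IP? j ∘ at) (allFin (len c))) ⟩
    length (filter (IP? j ∘ at) (allFin (len c)))           ≤⟨ length-filter-≤ toℕ (IP? j ∘ at) IP-labels-close
                                                                 (AllPairs.tabulate⁺-< {f = id} id) ⟩
    t                                                        ∎
    where
    open ≤-Reasoning
    at : Fin (len c) → Instr
    at = c ,_

lemma4 : (t : ℕ) → 1 ≤ t → (P : Program) → (σ : Trace P) →
    ReorderingBounded P σ t →
    (j : ℕ) → j ≤ Trace.N σ →
    Trace.∣IP∣ σ j ≤ Program.nCores P * t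
lemma4 t _ P σ bounded j _ =
  subst (λ n → ∣IP∣ j ≤ n * t) (length-tabulate {n = nCores} id)
    (length-filter-concatMap-≤ (IP? j) (instrsOn P)
      (∣IP∣-on-core σ bounded j) (allFin nCores))
  where
  open Program P
  open Trace σ
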